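{- Let $k\ge 4$ and consider the Game of Cycles on the $1$-$2$-$k$ graph. Player 1 has a winning strategy when $k$ is even, and Player 2 has a winning strategy when $k$ is odd.
   Context: Game of Cycles: the gameboard is a simple connected graph drawn in the plane without crossings. Players 1 and 2 alternate turns, Player 1 first; on a turn a player must, if possible, direct one currently undirected edge, and it is illegal to create a sink (a vertex all of whose incident edges point into it) or a source (a vertex all of whose incident edges point out of it). A cycle cell is a cycle of the graph bounding a bounded face of the drawing; a player who directs an edge so that all edges of some cycle cell are directed consistently around it wins immediately. Otherwise the player who makes the last legal move wins. A $j$-$2$-$k$ graph consists of two vertices joined by three internally disjoint paths: an upper path with $j$ edges, a middle path with $2$ edges, and a lower path with $k$ edges, all other vertices having degree $2$; it is drawn with the middle path between the upper and lower paths, so its cycle cells are the $(j+2)$-cycle formed by the upper and middle paths and the $(k+2)$-cycle formed by the middle and lower paths. (For $j=1$ the upper path is a single edge joining the two degree-3 vertices, and the upper cycle cell is a triangle.) -}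

module Defs where

open import Data.Nat using (ℕ; zero; suc; _+_; _*_; _≤_)
open import Data.Fin using (Fin; fromℕ; inject₁) renaming (zero to fzero; suc to fsuc)
import Data.Fin as F
open import Data.Maybe using (Maybe; just; nothing)
open import Data.Product using (Σ; ∃; ∃-syntax; _×_; _,_)
open import Data.Sum using (_⊎_)
open import Relation.Nullary using (¬_; yes; no)
open import Relation.Binary.PropositionalEquality using (_≡_)

-- The 1-2-k graph.
-- Vertices: the lower path is p_0, p_1, ..., p_k  (pos i), where
-- p_0 and p_k are the two degree-3 vertices; `mid` is the interior
-- vertex of the middle path.

data Vtx (k : ℕ) : Set where
  pos : Fin (suc k) → Vtx k
  mid : Vtx k

-- Edges: `up` is the single upper edge p_0 — p_k,
-- `midL` is p_0 — mid, `midR` is mid — p_k,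
-- `low i` is p_i — p_{i+1} (i < k).
data Edge (k : ℕ) : Set where
  up   : Edge k
  midL : Edge k
  midR : Edge k
  low  : Fin k → Edge k

tl : {k : ℕ} → Edge k → Vtx k
tl up      = pos fzero
tl midL    = pos fzero
tl midR    = mid
tl (low i) = pos (inject₁ i)

hd : {k : ℕ} → Edge k → Vtx k
hd {k} up   = pos (fromℕ k)
hd midL     = mid
hd {k} midR = pos (fromℕ k)
hd (low i)  = pos (fsuc i)

data Dir : Set where
  fwd bwd : Dir

flip : Dir → Dir
flip fwd = bwd
flip bwd = fwd

into : {k : ℕ} → Edge k → Dir → Vtx k
into e fwd = hd e
into e bwd = tl e

outof : {k : ℕ} → Edge k → Dir → Vtx k
outof e fwd = tl e
outof e bwd = hd e

State : ℕ → Set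
State k = Edge k → Maybe Dir

initial : (k : ℕ) → State k
initial k e = nothing

Incident : {k : ℕ} → Edge k → Vtx k → Set
Incident e v = (tl e ≡ v) ⊎ (hd e ≡ v)

Sink : {k : ℕ} → State k → Vtx k → Set
Sink {k} s v = (e : Edge k) → Incident e v → ∃[ d ] (s e ≡ just d × into e d ≡ v)

Source : {k : ℕ} → State k → Vtx k → Set
Source {k} s v = (e : Edge k) → Incident e v → ∃[ d ] (s e ≡ just d × outof e d ≡ v)

NoSinkSource : {k : ℕ} → State k → Set
NoSinkSource {k} s = (v : Vtx k) → ¬ Sink s v × ¬ Source s v

_≟E_ : {k : ℕ} → (e f : Edge k) → Relation.Nullary.Dec (e ≡ f)
up ≟E up = yes Relation.Binary.PropositionalEquality.refl
up ≟E midL = no λ ()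
up ≟E midR = no λ ()
up ≟E low _ = no λ ()
midL ≟E up = no λ ()
midL ≟E midL = yes Relation.Binary.PropositionalEquality.refl
midL ≟E midR = no λ ()
midL ≟E low _ = no λ ()
midR ≟E up = no λ ()
midR ≟E midL = no λ ()
midR ≟E midR = yes Relation.Binary.PropositionalEquality.refl
midR ≟E low _ = no λ ()
low _ ≟E up = no λ ()
low _ ≟E midL = no λ ()
low _ ≟E midR = no λ ()
low i ≟E low j with i F.≟ j
... | yes Relation.Binary.PropositionalEquality.refl = yes Relation.Binary.PropositionalEquality.refl
... | no i≢j = no λ { Relation.Binary.PropositionalEquality.refl → i≢j Relation.Binary.PropositionalEquality.refl }

play : {k : ℕ} → State k → Edge k → Dir → State k
play s e d f with f ≟E e
... | yes _ = just d
... | no _  = s f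

Legal : {k : ℕ} → State k → Edge k → Dir → Set
Legal s e d = (s e ≡ nothing) × NoSinkSource (play s e d)

-- Cycle cells: the triangle (upper + middle paths) and the
-- (k+2)-cycle (middle + lower paths).  `trav c e` is the direction in
-- which edge e is traversed when walking once around c (nothing if e
-- is not on c).
--   triangle : p_0 → p_k (up) → mid (midR backwards) → p_0 (midL backwards)
--   big      : p_0 → mid (midL) → p_k (midR) → p_{k-1} → … → p_0 (low edges backwards)

data Cell : Set where
  triangle big : Cell

trav : {k : ℕ} → Cell → Edge k → Maybe Dir
trav triangle up      = just fwd
trav triangle midL    = just bwd
trav triangle midR    = just bwd
trav triangle (low _) = nothing
trav big up           = nothing
trav big midL         = just fwd
trav big midR         = just fwd
trav big (low _)      = just bwd

CycleDirected : {k : ℕ} → State k → Cell → Set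
CycleDirected {k} s c =
  ((e : Edge k) (d : Dir) → trav c e ≡ just d → s e ≡ just d)
  ⊎ ((e : Edge k) (d : Dir) → trav c e ≡ just d → s e ≡ just (flip d))

SomeCycle : {k : ℕ} → State k → Set
SomeCycle s = ∃[ c ] CycleDirected s c

-- Lose s : the other player has a winning strategy from s, i.e. every
--          legal move neither completes a cycle cell nor avoids leaving
--          the opponent in a winning position (vacuous if no legal move:
--          the previous player made the last move and wins).

data Win  {k : ℕ} (s : State k) : Set
data Lose {k : ℕ} (s : State k) : Set

data Win {k} s where
  move : (e : Edge k) (d : Dir) → Legal s e d →
         (SomeCycle (play s e d) ⊎ Lose (play s e d)) → Win s

data Lose {k} s where
  allMoves : ((e : Edge k) (d : Dir) → Legal s e d →
              ¬ SomeCycle (play s e d) × Win (play s e d)) → Lose s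

Even Odd : ℕ → Set
Even k = ∃[ n ] k ≡ 2 * n
Odd  k = ∃[ n ] k ≡ suc (2 * n)

Player1Wins Player2Wins : ℕ → Set
Player1Wins k = Win (initial k)
Player2Wins k = Lose (initial k)

module Submission where

-- Call a position triangle-blocked when the upper edge and one middle edge are directed the same
-- way: the triangle can then never be completed, and the big cycle only by the last possible move.
-- In a triangle-blocked position without sink or source a legal move exists whenever an odd number
-- of edges is undirected. Otherwise every undirected edge of the lower path would lie between two
-- oppositely directed neighbours, so along the path the direction flips exactly once per undirected
-- edge, and the directions forced at the two ends of the path contradict that parity. Hence from a
-- triangle-blocked position the player to move wins exactly when the number of undirected edges is
-- odd. Player 1 (k even) opens with the upper edge; Player 2 (k odd) answers the first move by
-- blocking the triangle, or, after a lower edge, by directing the upper edge against it. From then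
-- on the winner answers a middle edge by completing the triangle or keeping it blocked, and a lower
-- edge by blocking the triangle; both keep the parity in the winner's favour.

open import Defs
open import Data.Empty using (⊥-elim)
open import Data.Fin using (Fin; fromℕ; inject₁; toℕ) renaming (zero to fzero; suc to fsuc)
import Data.Fin as Fin
import Data.Fin.Properties as Finₚ
open import Data.Maybe using (Maybe; just; nothing)
open import Data.Maybe.Properties using (just-injective; ≡-dec)
open import Data.Nat using (ℕ; zero; suc; _+_; _*_; _≤_; s≤s; parity)
open import Data.Nat.GeneralisedArithmetic using (iterate)
import Data.Nat.Properties as ℕₚ
open import Data.Parity.Base using (0ℙ; 1ℙ; _⁻¹)
import Data.Parity.Properties as ℙₚ
open import Data.Product using (∃; ∃-syntax; ∃₂; _×_; _,_; proj₁; proj₂)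
open import Data.Sum using (_⊎_; inj₁; inj₂; [_,_]′)
import Data.Sum as Sum
open import Data.Unit using (⊤; tt)
open import Function using (_∘_)
open import Relation.Nullary using (¬_; Dec; yes; no)
open import Relation.Binary.PropositionalEquality

flip-involutive : ∀ d → flip (flip d) ≡ d
flip-involutive fwd = refl
flip-involutive bwd = refl

flip-≢ : ∀ d → flip d ≢ d
flip-≢ fwd ()
flip-≢ bwd ()

≢⇒flip : ∀ {a b} → a ≢ b → flip a ≡ b
≢⇒flip {fwd} {fwd} a≢b = ⊥-elim (a≢b refl)
≢⇒flip {fwd} {bwd} _   = refl
≢⇒flip {bwd} {fwd} _   = refl
≢⇒flip {bwd} {bwd} a≢b = ⊥-elim (a≢b refl)

_≟D_ : (a b : Dir) → Dec (a ≡ b)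
fwd ≟D fwd = yes refl
fwd ≟D bwd = no λ ()
bwd ≟D fwd = no λ ()
bwd ≟D bwd = yes refl

nothing≢just : ∀ {A : Set} {x : A} → nothing ≢ just x
nothing≢just ()

≡nothing⇒≢just : ∀ {x : Maybe Dir} {d} → x ≡ nothing → x ≢ just d
≡nothing⇒≢just x≡nothing = nothing≢just ∘ trans (sym x≡nothing)

≡just⇒≢flip : ∀ {x d} → x ≡ just d → x ≢ just (flip d)
≡just⇒≢flip {d = d} x≡d x≡flip = flip-≢ d (sym (just-injective (trans (sym x≡d) x≡flip)))

parity-suc : ∀ n → parity (suc n) ≡ parity n ⁻¹
parity-suc n = sym (ℙₚ.⁻¹-selfInverse (ℙₚ.suc-homo-⁻¹ n))

parity-pred : ∀ n {p} → parity (suc n) ≡ p → parity n ≡ p ⁻¹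
parity-pred n eq = trans (sym (ℙₚ.suc-homo-⁻¹ n)) (cong _⁻¹ eq)

even-parity : ∀ {n} → Even n → parity n ≡ 0ℙ
even-parity (m , refl) = ℙₚ.*-homo-* 2 m

odd-parity : ∀ {n} → Odd n → parity n ≡ 1ℙ
odd-parity (m , refl) = trans (parity-suc (2 * m)) (cong _⁻¹ (ℙₚ.*-homo-* 2 m))

iterate-flip-even : ∀ n a → parity n ≡ 0ℙ → iterate flip a n ≡ a
iterate-flip-even zero          a _ = refl
iterate-flip-even (suc (suc n)) a p rewrite flip-involutive a = iterate-flip-even n a p

iterate-flip-odd : ∀ n a → parity n ≡ 1ℙ → iterate flip a n ≡ flip a
iterate-flip-odd (suc zero)    a _ = refl
iterate-flip-odd (suc (suc n)) a p rewrite flip-involutive a = iterate-flip-odd n a p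

data LastOrInject₁ : ∀ {n} → Fin (suc n) → Set where
  last   : ∀ {n} → LastOrInject₁ (fromℕ n)
  inject : ∀ {n} (j : Fin n) → LastOrInject₁ (inject₁ j)

lastOrInject₁ : ∀ {n} (i : Fin (suc n)) → LastOrInject₁ i
lastOrInject₁ {zero}  fzero    = last
lastOrInject₁ {suc n} fzero    = inject fzero
lastOrInject₁ {suc n} (fsuc i) with lastOrInject₁ i
... | last     = last
... | inject j = inject (fsuc j)

inject₁≢suc : ∀ {n} (i : Fin n) → inject₁ i ≢ fsuc i
inject₁≢suc i eq = ℕₚ.1+n≢n (sym (trans (sym (Finₚ.toℕ-inject₁ i)) (cong toℕ eq)))

undirected : Maybe Dir → ℕ
undirected nothing  = 1
undirected (just _) = 0

countUndirected : ∀ {n} → (Fin n → Maybe Dir) → ℕ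
countUndirected {zero}  g = 0
countUndirected {suc n} g = undirected (g fzero) + countUndirected (g ∘ fsuc)

countUndirected-nothing : ∀ n → countUndirected {n} (λ _ → nothing) ≡ n
countUndirected-nothing zero    = refl
countUndirected-nothing (suc n) = cong suc (countUndirected-nothing n)

countUndirected-directed : ∀ {n} {g : Fin n → Maybe Dir} → (∀ i → g i ≢ nothing) → countUndirected g ≡ 0
countUndirected-directed {zero}      directed = refl
countUndirected-directed {suc n} {g} directed with g fzero in g₀
... | nothing = ⊥-elim (directed fzero g₀)
... | just _  = countUndirected-directed (directed ∘ fsuc)

countUndirected-cong : ∀ {n} {g h : Fin n → Maybe Dir} → (∀ i → g i ≡ h i) →
  countUndirected g ≡ countUndirected h
countUndirected-cong {zero}  g≗h = refl
countUndirected-cong {suc n} g≗h =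
  cong₂ _+_ (cong undirected (g≗h fzero)) (countUndirected-cong (g≗h ∘ fsuc))

countUndirected-direct : ∀ {n} {g h : Fin n → Maybe Dir} i {d} →
  g i ≡ nothing → h i ≡ just d → (∀ j → j ≢ i → h j ≡ g j) →
  countUndirected g ≡ suc (countUndirected h)
countUndirected-direct {suc n} fzero g≡nothing h≡just others rewrite g≡nothing | h≡just =
  cong suc (countUndirected-cong λ j → sym (others (fsuc j) λ ()))
countUndirected-direct {suc n} {g} {h} (fsuc i) g≡nothing h≡just others rewrite others fzero (λ ()) =
  trans (cong (undirected (g fzero) +_) (countUndirected-direct i g≡nothing h≡just others′))
        (ℕₚ.+-suc (undirected (g fzero)) _)
  where
  others′ : ∀ j → j ≢ i → h (fsuc j) ≡ g (fsuc j)
  others′ j j≢i = others (fsuc j) (j≢i ∘ Finₚ.suc-injective)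

-- A path with edges g 0, …, g n, all oriented the same way along the path; a and b are the
-- directions of two further directed edges just before g 0 and just after g n.

Compatible : Maybe Dir → Maybe Dir → Set
Compatible (just a) (just b) = a ≡ b
Compatible _        _        = ⊤

before : ∀ {n} → Dir → (Fin (suc n) → Maybe Dir) → Fin (suc n) → Maybe Dir
before a g fzero    = just a
before a g (fsuc i) = g (inject₁ i)

after : ∀ {n} → Dir → (Fin (suc n) → Maybe Dir) → Fin (suc n) → Maybe Dir
after {zero}  b g _        = just b
after {suc n} b g fzero    = g (fsuc fzero)
after {suc n} b g (fsuc i) = after b (g ∘ fsuc) i

after-last : ∀ {n} b (g : Fin (suc n) → Maybe Dir) → after b g (fromℕ n) ≡ just b
after-last {zero}  b g = refl
after-last {suc n} b g = after-last b (g ∘ fsuc)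

after-inject₁ : ∀ {n} b (g : Fin (suc n) → Maybe Dir) j → after b g (inject₁ j) ≡ g (fsuc j)
after-inject₁ {suc n} b g fzero    = refl
after-inject₁ {suc n} b g (fsuc j) = after-inject₁ b (g ∘ fsuc) j

Coherent : ∀ {n} → Dir → (Fin (suc n) → Maybe Dir) → Dir → Set
Coherent {n} a g b = (∀ i → Compatible (before a g i) (g i)) × Compatible (g (fromℕ n)) (just b)

Playable : ∀ {n} → Dir → (Fin (suc n) → Maybe Dir) → Dir → Fin (suc n) → Dir → Set
Playable a g b i d = g i ≡ nothing × Compatible (before a g i) (just d) × Compatible (just d) (after b g i)

compatible-≢ʳ : ∀ {x d} → Compatible x (just d) → x ≢ just (flip d)
compatible-≢ʳ {just _} refl eq = flip-≢ _ (sym (just-injective eq))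

compatible-≢ˡ : ∀ {x d} → Compatible (just d) x → x ≢ just (flip d)
compatible-≢ˡ {just _} refl eq = flip-≢ _ (sym (just-injective eq))

≢-compatibleˡ : ∀ {x d} → x ≢ just d → Compatible (just (flip d)) x
≢-compatibleˡ {nothing}     _  = tt
≢-compatibleˡ {just y} {d} x≢ = ≢⇒flip λ d≡y → x≢ (cong just (sym d≡y))

≢-compatibleʳ : ∀ {x d} → x ≢ just d → Compatible x (just (flip d))
≢-compatibleʳ {nothing} _  = tt
≢-compatibleʳ {just _}  x≢ = sym (≢-compatibleˡ x≢)

playable⊎alternating : ∀ {n} a (g : Fin (suc n) → Maybe Dir) b → Coherent a g b →
  ∃₂ (Playable a g b) ⊎ iterate flip a (countUndirected g) ≡ b
playable⊎alternating {zero} a g b (steps , end) with g fzero in g₀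
... | just c = inj₂ (trans (subst (Compatible (just a)) g₀ (steps fzero)) end)
... | nothing with a ≟D b
...   | yes refl = inj₁ (fzero , a , g₀ , refl , refl)
...   | no a≢b   = inj₂ (≢⇒flip a≢b)
playable⊎alternating {suc n} a g b (steps , end) with g fzero in g₀
... | just c with subst (Compatible (just a)) g₀ (steps fzero)
...   | refl with playable⊎alternating a (g ∘ fsuc) b (tailSteps , end)
  where
  tailSteps : ∀ i → Compatible (before a (g ∘ fsuc) i) (g (fsuc i))
  tailSteps fzero    = subst (λ x → Compatible x (g (fsuc fzero))) g₀ (steps (fsuc fzero))
  tailSteps (fsuc i) = steps (fsuc (fsuc i))
...     | inj₁ (fzero , d , free , l , r) =
  inj₁ (fsuc fzero , d , free , subst (λ x → Compatible x (just d)) (sym g₀) l , r)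
...     | inj₁ (fsuc i , d , playable) = inj₁ (fsuc (fsuc i) , d , playable)
...     | inj₂ alternating             = inj₂ alternating
playable⊎alternating {suc n} a g b (steps , end) | nothing = continue (g (fsuc fzero)) refl
  where
  continue : ∀ x → g (fsuc fzero) ≡ x →
    ∃₂ (Playable a g b) ⊎ iterate flip a (suc (countUndirected (g ∘ fsuc))) ≡ b
  continue nothing g₁ = inj₁ (fzero , a , g₀ , refl , subst (Compatible (just a)) (sym g₁) tt)
  continue (just c) g₁ with c ≟D a
  ... | yes refl = inj₁ (fzero , a , g₀ , refl , subst (Compatible (just a)) (sym g₁) refl)
  ... | no c≢a with ≢⇒flip (c≢a ∘ sym)
  ...   | refl with playable⊎alternating (flip a) (g ∘ fsuc) b (tailSteps , end)
    where
    tailSteps : ∀ i → Compatible (before (flip a) (g ∘ fsuc) i) (g (fsuc i))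
    tailSteps fzero    = subst (Compatible (just (flip a))) (sym g₁) refl
    tailSteps (fsuc i) = steps (fsuc (fsuc i))
  ...     | inj₁ (fzero , _ , free , _)  = ⊥-elim (≡nothing⇒≢just free g₁)
  ...     | inj₁ (fsuc i , d , playable) = inj₁ (fsuc (fsuc i) , d , playable)
  ...     | inj₂ alternating             = inj₂ alternating

pos-injective : ∀ {k} {i j : Fin (suc k)} → pos {k} i ≡ pos j → i ≡ j
pos-injective refl = refl

low-injective : ∀ {k} {i j : Fin k} → low i ≡ low j → i ≡ j
low-injective refl = refl

_≟V_ : ∀ {k} (v w : Vtx k) → Dec (v ≡ w)
pos i ≟V pos j with i Fin.≟ j
... | yes refl = yes refl
... | no i≢j   = no (i≢j ∘ pos-injective)
pos _ ≟V mid   = no λ ()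
mid   ≟V pos _ = no λ ()
mid   ≟V mid   = yes refl

tl≢hd : ∀ {k} (e : Edge (suc k)) → tl e ≢ hd e
tl≢hd up      ()
tl≢hd midL    ()
tl≢hd midR    ()
tl≢hd (low i) = inject₁≢suc i ∘ pos-injective

into≢outof : ∀ {k} (e : Edge (suc k)) d → into e d ≢ outof e d
into≢outof e fwd = tl≢hd e ∘ sym
into≢outof e bwd = tl≢hd e

incident-outof : ∀ {k} (e : Edge k) d → Incident e (outof e d)
incident-outof e fwd = inj₁ refl
incident-outof e bwd = inj₂ refl

incident-into : ∀ {k} (e : Edge k) d → Incident e (into e d)
incident-into e fwd = inj₂ refl
incident-into e bwd = inj₁ refl

play-≡ : ∀ {k} (s : State k) e d → play s e d e ≡ just d
play-≡ s e d with e ≟E e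
... | yes _  = refl
... | no e≢e = ⊥-elim (e≢e refl)

play-≢ : ∀ {k} (s : State k) {e f} d → f ≢ e → play s e d f ≡ s f
play-≢ s {e} {f} d f≢e with f ≟E e
... | yes f≡e = ⊥-elim (f≢e f≡e)
... | no _    = refl

play-≡⊎≡ : ∀ {k} (s : State k) e d f → play s e d f ≡ just d ⊎ play s e d f ≡ s f
play-≡⊎≡ s e d f with f ≟E e
... | yes _ = inj₁ refl
... | no _  = inj₂ refl

play-keeps-directed : ∀ {k} (s : State k) {e f x} d → s e ≡ nothing → s f ≡ just x → play s e d f ≡ just x
play-keeps-directed s d free directed =
  trans (play-≢ s d λ { refl → ≡nothing⇒≢just free directed }) directed

Balanced : ∀ {k} → State k → Vtx k → Set
Balanced t v = ¬ Sink t v × ¬ Source t v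

Movable : ∀ {k} → State k → Set
Movable s = ∃₂ (Legal s)

notSource : ∀ {k} {t : State k} {v} f → Incident f v →
  (∀ x → t f ≡ just x → outof f x ≢ v) → ¬ Source t v
notSource f inc notOut source = let x , tf≡x , out≡v = source f inc in notOut x tf≡x out≡v

notSink : ∀ {k} {t : State k} {v} f → Incident f v →
  (∀ x → t f ≡ just x → into f x ≢ v) → ¬ Sink t v
notSink f inc notIn sink = let x , tf≡x , in≡v = sink f inc in notIn x tf≡x in≡v

undirected-balances : ∀ {k} {t : State k} {v} f → Incident f v → t f ≡ nothing → Balanced t v
undirected-balances f inc tf≡nothing =
  notSink   f inc (λ _ tf≡x _ → ≡nothing⇒≢just tf≡nothing tf≡x) ,
  notSource f inc (λ _ tf≡x _ → ≡nothing⇒≢just tf≡nothing tf≡x)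

initial-noSinkSource : ∀ {k} → NoSinkSource (initial k)
initial-noSinkSource (pos fzero)    = undirected-balances up (inj₁ refl) refl
initial-noSinkSource (pos (fsuc i)) = undirected-balances (low i) (inj₂ refl) refl
initial-noSinkSource mid            = undirected-balances midL (inj₂ refl) refl

-- Directing e forwards can only turn its tail into a source and its head into a sink;
-- backwards, the other way round.

TailSafe : ∀ {k} → State k → Edge k → Dir → Set
TailSafe t e fwd = ¬ Source t (tl e)
TailSafe t e bwd = ¬ Sink t (tl e)

HeadSafe : ∀ {k} → State k → Edge k → Dir → Set
HeadSafe t e fwd = ¬ Sink t (hd e)
HeadSafe t e bwd = ¬ Source t (hd e)

module _ {k : ℕ} {s : State (suc k)} {e : Edge (suc k)} where

  unchanged : ∀ {d f x} → f ≢ e → play s e d f ≡ just x → s f ≡ just x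
  unchanged {d} f≢e = trans (sym (play-≢ s d f≢e))

  played-notSink : ∀ d → ¬ Sink (play s e d) (outof e d)
  played-notSink d sink with sink e (incident-outof e d)
  ... | x , eq , in≡out with just-injective (trans (sym (play-≡ s e d)) eq)
  ... | refl = into≢outof e d in≡out

  played-notSource : ∀ d → ¬ Source (play s e d) (into e d)
  played-notSource d source with source e (incident-into e d)
  ... | x , eq , out≡in with just-injective (trans (sym (play-≡ s e d)) eq)
  ... | refl = into≢outof e d (sym out≡in)

  tail-balanced : ∀ d → TailSafe (play s e d) e d → Balanced (play s e d) (tl e)
  tail-balanced fwd safe = played-notSink fwd , safe
  tail-balanced bwd safe = safe , played-notSource bwd

  head-balanced : ∀ d → HeadSafe (play s e d) e d → Balanced (play s e d) (hd e)
  head-balanced fwd safe = safe , played-notSource fwd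
  head-balanced bwd safe = played-notSink bwd , safe

  away-balanced : ∀ d {v} → NoSinkSource s → tl e ≢ v → hd e ≢ v → Balanced (play s e d) v
  away-balanced d {v} nss tl≢v hd≢v =
    (λ sink   → proj₁ (nss v) λ f inc → beforeMove inc (sink f inc)) ,
    (λ source → proj₂ (nss v) λ f inc → beforeMove inc (source f inc))
    where
    f≢e : ∀ {f} → Incident f v → f ≢ e
    f≢e (inj₁ tl≡v) refl = tl≢v tl≡v
    f≢e (inj₂ hd≡v) refl = hd≢v hd≡v
    beforeMove : ∀ {f} {P : Dir → Set} → Incident f v →
      ∃[ x ] play s e d f ≡ just x × P x → ∃[ x ] s f ≡ just x × P x
    beforeMove inc (x , eq , px) = x , unchanged (f≢e inc) eq , px

  legal : ∀ {d} → NoSinkSource s → s e ≡ nothing →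
    TailSafe (play s e d) e d → HeadSafe (play s e d) e d → Legal s e d
  legal {d} nss free tailSafe headSafe = free , balanced
    where
    balanced : NoSinkSource (play s e d)
    balanced v with tl e ≟V v | hd e ≟V v
    ... | yes refl | _        = tail-balanced d tailSafe
    ... | no _     | yes refl = head-balanced d headSafe
    ... | no tl≢v  | no hd≢v  = away-balanced d nss tl≢v hd≢v

  tailSafe-after : ∀ {d} f → f ≢ e → hd f ≡ tl e → s f ≢ just (flip d) → TailSafe (play s e d) e d
  tailSafe-after {fwd} f f≢e hd≡ blocked = notSource f (inj₂ hd≡) λ where
    fwd _  tl≡ → tl≢hd f (trans tl≡ (sym hd≡))
    bwd eq _   → blocked (unchanged f≢e eq)
  tailSafe-after {bwd} f f≢e hd≡ blocked = notSink f (inj₂ hd≡) λ where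
    fwd eq _   → blocked (unchanged f≢e eq)
    bwd _  tl≡ → tl≢hd f (trans tl≡ (sym hd≡))

  tailSafe-beside : ∀ {d} f → f ≢ e → tl f ≡ tl e → s f ≢ just d → TailSafe (play s e d) e d
  tailSafe-beside {fwd} f f≢e tl≡ blocked = notSource f (inj₁ tl≡) λ where
    fwd eq _   → blocked (unchanged f≢e eq)
    bwd _  hd≡ → tl≢hd f (trans tl≡ (sym hd≡))
  tailSafe-beside {bwd} f f≢e tl≡ blocked = notSink f (inj₁ tl≡) λ where
    fwd _  hd≡ → tl≢hd f (trans tl≡ (sym hd≡))
    bwd eq _   → blocked (unchanged f≢e eq)

  headSafe-before : ∀ {d} f → f ≢ e → tl f ≡ hd e → s f ≢ just (flip d) → HeadSafe (play s e d) e d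
  headSafe-before {fwd} f f≢e tl≡ blocked = notSink f (inj₁ tl≡) λ where
    fwd _  hd≡ → tl≢hd f (trans tl≡ (sym hd≡))
    bwd eq _   → blocked (unchanged f≢e eq)
  headSafe-before {bwd} f f≢e tl≡ blocked = notSource f (inj₁ tl≡) λ where
    fwd eq _   → blocked (unchanged f≢e eq)
    bwd _  hd≡ → tl≢hd f (trans tl≡ (sym hd≡))

  headSafe-beside : ∀ {d} f → f ≢ e → hd f ≡ hd e → s f ≢ just d → HeadSafe (play s e d) e d
  headSafe-beside {fwd} f f≢e hd≡ blocked = notSink f (inj₂ hd≡) λ where
    fwd eq _   → blocked (unchanged f≢e eq)
    bwd _  tl≡ → tl≢hd f (trans tl≡ (sym hd≡))
  headSafe-beside {bwd} f f≢e hd≡ blocked = notSource f (inj₂ hd≡) λ where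
    fwd _  tl≡ → tl≢hd f (trans tl≡ (sym hd≡))
    bwd eq _   → blocked (unchanged f≢e eq)

  FreeAt : Vtx (suc k) → Set
  FreeAt v = ∃[ f ] f ≢ e × Incident f v × s f ≡ nothing

  free-balanced : ∀ {d v} → FreeAt v → Balanced (play s e d) v
  free-balanced {d} (f , f≢e , inc , free) = undirected-balances f inc (trans (play-≢ s d f≢e) free)

  legal-free : ∀ {d} → NoSinkSource s → s e ≡ nothing → FreeAt (tl e) → FreeAt (hd e) → Legal s e d
  legal-free {fwd} nss free atTl atHd = legal nss free (proj₂ (free-balanced atTl)) (proj₁ (free-balanced atHd))
  legal-free {bwd} nss free atTl atHd = legal nss free (proj₁ (free-balanced atTl)) (proj₂ (free-balanced atHd))

edgeAt : ∀ {k} → Fin (3 + k) → Edge k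
edgeAt fzero                  = up
edgeAt (fsuc fzero)           = midL
edgeAt (fsuc (fsuc fzero))    = midR
edgeAt (fsuc (fsuc (fsuc i))) = low i

edgeIndex : ∀ {k} → Edge k → Fin (3 + k)
edgeIndex up      = fzero
edgeIndex midL    = fsuc fzero
edgeIndex midR    = fsuc (fsuc fzero)
edgeIndex (low i) = fsuc (fsuc (fsuc i))

edgeIndex-edgeAt : ∀ {k} (j : Fin (3 + k)) → edgeIndex (edgeAt j) ≡ j
edgeIndex-edgeAt fzero                  = refl
edgeIndex-edgeAt (fsuc fzero)           = refl
edgeIndex-edgeAt (fsuc (fsuc fzero))    = refl
edgeIndex-edgeAt (fsuc (fsuc (fsuc i))) = refl

edgeAt-edgeIndex : ∀ {k} (e : Edge k) → edgeAt (edgeIndex e) ≡ e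
edgeAt-edgeIndex up      = refl
edgeAt-edgeIndex midL    = refl
edgeAt-edgeIndex midR    = refl
edgeAt-edgeIndex (low i) = refl

unplayed : ∀ {k} → State k → ℕ
unplayed s = countUndirected (s ∘ edgeAt)

unplayed-initial : ∀ k → unplayed (initial k) ≡ 3 + k
unplayed-initial k = countUndirected-nothing (3 + k)

unplayed-upDirected : ∀ {k} {s : State k} {f} → s up ≡ just f →
  unplayed s ≡ undirected (s midL) + (undirected (s midR) + countUndirected (s ∘ low))
unplayed-upDirected su rewrite su = refl

unplayed-play : ∀ {k} (s : State k) e d → s e ≡ nothing → unplayed s ≡ suc (unplayed (play s e d))
unplayed-play s e d free =
  countUndirected-direct (edgeIndex e)
    (trans (cong s (edgeAt-edgeIndex e)) free)
    (trans (cong (play s e d) (edgeAt-edgeIndex e)) (play-≡ s e d))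
    λ j j≢i → play-≢ s d λ eq → j≢i (trans (sym (edgeIndex-edgeAt j)) (cong edgeIndex eq))

module _ {k : ℕ} {s : State k} {e : Edge k} {d : Dir} (lg : Legal s e d) where

  unplayed-legal : ∀ {n} → unplayed s ≡ suc n → unplayed (play s e d) ≡ n
  unplayed-legal eq = ℕₚ.suc-injective (trans (sym (unplayed-play s e d (proj₁ lg))) eq)

  parity-after : parity (unplayed (play s e d)) ≡ parity (unplayed s) ⁻¹
  parity-after = parity-pred (unplayed (play s e d)) (cong parity (sym (unplayed-play s e d (proj₁ lg))))

  parity-afterTwo : ∀ {e′ d′} → Legal (play s e d) e′ d′ →
    parity (unplayed (play (play s e d) e′ d′)) ≡ parity (unplayed s)
  parity-afterTwo {e′} {d′} lg′ =
    cong parity (sym (trans (unplayed-play s e d (proj₁ lg))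
                            (cong suc (unplayed-play (play s e d) e′ d′ (proj₁ lg′)))))

module _ {k : ℕ} where

  incident-mid : ∀ {e : Edge (suc k)} → Incident e mid → e ≡ midL ⊎ e ≡ midR
  incident-mid {midL}  _ = inj₁ refl
  incident-mid {midR}  _ = inj₂ refl
  incident-mid {up}    (inj₁ ())
  incident-mid {up}    (inj₂ ())
  incident-mid {low _} (inj₁ ())
  incident-mid {low _} (inj₂ ())

  incident-inner : ∀ j {e : Edge (suc k)} → Incident e (pos (fsuc (inject₁ j))) →
    e ≡ low (inject₁ j) ⊎ e ≡ low (fsuc j)
  incident-inner j {up}    (inj₁ ())
  incident-inner j {up}    (inj₂ eq) = ⊥-elim (Finₚ.fromℕ≢inject₁ (Finₚ.suc-injective (pos-injective eq)))
  incident-inner j {midL}  (inj₁ ())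
  incident-inner j {midL}  (inj₂ ())
  incident-inner j {midR}  (inj₁ ())
  incident-inner j {midR}  (inj₂ eq) = ⊥-elim (Finₚ.fromℕ≢inject₁ (Finₚ.suc-injective (pos-injective eq)))
  incident-inner j {low i} (inj₁ eq) = inj₂ (cong low (Finₚ.inject₁-injective (pos-injective eq)))
  incident-inner j {low i} (inj₂ eq) = inj₁ (cong low (Finₚ.suc-injective (pos-injective eq)))

  incident-start : ∀ {e : Edge (suc k)} → Incident e (pos fzero) → e ≡ up ⊎ e ≡ midL ⊎ e ≡ low fzero
  incident-start {up}           _         = inj₁ refl
  incident-start {midL}         _         = inj₂ (inj₁ refl)
  incident-start {midR}         (inj₁ ())
  incident-start {midR}         (inj₂ ())
  incident-start {low fzero}    _         = inj₂ (inj₂ refl)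
  incident-start {low (fsuc _)} (inj₁ ())
  incident-start {low (fsuc _)} (inj₂ ())

  incident-end : ∀ {e : Edge (suc k)} → Incident e (pos (fromℕ (suc k))) →
    e ≡ up ⊎ e ≡ midR ⊎ e ≡ low (fromℕ k)
  incident-end {up}    _         = inj₁ refl
  incident-end {midL}  (inj₁ ())
  incident-end {midL}  (inj₂ ())
  incident-end {midR}  _         = inj₂ (inj₁ refl)
  incident-end {low i} (inj₁ eq) = ⊥-elim (Finₚ.fromℕ≢inject₁ (sym (pos-injective eq)))
  incident-end {low i} (inj₂ eq) = inj₂ (inj₂ (cong low (Finₚ.suc-injective (pos-injective eq))))

  module _ {s : State (suc k)} (nss : NoSinkSource s) where

    degree-two-compatible : ∀ {v e₁ e₂} → (∀ {e} → Incident e v → e ≡ e₁ ⊎ e ≡ e₂) →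
      hd e₁ ≡ v → tl e₂ ≡ v → Compatible (s e₁) (s e₂)
    degree-two-compatible {v} {e₁} {e₂} edges hd≡v tl≡v with s e₁ in s₁ | s e₂ in s₂
    ... | nothing  | _        = tt
    ... | just _   | nothing  = tt
    ... | just fwd | just fwd = refl
    ... | just bwd | just bwd = refl
    ... | just fwd | just bwd = ⊥-elim (proj₁ (nss v) λ e inc → into-v (edges inc))
      where
      into-v : ∀ {e} → e ≡ e₁ ⊎ e ≡ e₂ → ∃[ x ] s e ≡ just x × into e x ≡ v
      into-v (inj₁ refl) = fwd , s₁ , hd≡v
      into-v (inj₂ refl) = bwd , s₂ , tl≡v
    ... | just bwd | just fwd = ⊥-elim (proj₂ (nss v) λ e inc → outof-v (edges inc))
      where
      outof-v : ∀ {e} → e ≡ e₁ ⊎ e ≡ e₂ → ∃[ x ] s e ≡ just x × outof e x ≡ v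
      outof-v (inj₁ refl) = bwd , s₁ , hd≡v
      outof-v (inj₂ refl) = fwd , s₂ , tl≡v

    mid-agrees : ∀ {x y} → s midL ≡ just x → s midR ≡ just y → x ≡ y
    mid-agrees sl sr = subst₂ Compatible sl sr (degree-two-compatible incident-mid refl refl)

    tails-not-uniform : ∀ {v f} → ¬ (∀ {e} → Incident e v → s e ≡ just f × tl e ≡ v)
    tails-not-uniform {v} {fwd} uniform = proj₂ (nss v) λ e inc → fwd , uniform inc
    tails-not-uniform {v} {bwd} uniform = proj₁ (nss v) λ e inc → bwd , uniform inc

    heads-not-uniform : ∀ {v f} → ¬ (∀ {e} → Incident e v → s e ≡ just f × hd e ≡ v)
    heads-not-uniform {v} {fwd} uniform = proj₁ (nss v) λ e inc → fwd , uniform inc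
    heads-not-uniform {v} {bwd} uniform = proj₂ (nss v) λ e inc → bwd , uniform inc

    start-corner : ∀ {f} → s up ≡ just f → s midL ≡ just f → s (low fzero) ≢ just f
    start-corner {f} su sm sl = tails-not-uniform λ inc → directed (incident-start inc)
      where
      directed : ∀ {e} → e ≡ up ⊎ e ≡ midL ⊎ e ≡ low fzero → s e ≡ just f × tl e ≡ pos fzero
      directed (inj₁ refl)        = su , refl
      directed (inj₂ (inj₁ refl)) = sm , refl
      directed (inj₂ (inj₂ refl)) = sl , refl

    end-corner : ∀ {f} → s up ≡ just f → s midR ≡ just f → s (low (fromℕ k)) ≢ just f
    end-corner {f} su sm sl = heads-not-uniform λ inc → directed (incident-end inc)
      where
      directed : ∀ {e} → e ≡ up ⊎ e ≡ midR ⊎ e ≡ low (fromℕ k) →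
        s e ≡ just f × hd e ≡ pos (fromℕ (suc k))
      directed (inj₁ refl)        = su , refl
      directed (inj₂ (inj₁ refl)) = sm , refl
      directed (inj₂ (inj₂ refl)) = sl , refl

  -- The edges at either end of the lower path that are not on it act, for the path lemma,
  -- like one more path edge directed a (before low 0), resp. b (after the last lower edge).

  LeftEnd : State (suc k) → Dir → Set
  LeftEnd s a = Compatible (just a) (s (low fzero)) ×
    (s (low fzero) ≡ nothing → TailSafe (play s (low fzero) a) (low fzero) a)

  RightEnd : State (suc k) → Dir → Set
  RightEnd s b = Compatible (s (low (fromℕ k))) (just b) ×
    (s (low (fromℕ k)) ≡ nothing → HeadSafe (play s (low (fromℕ k)) b) (low (fromℕ k)) b)

  module _ {s : State (suc k)} (nss : NoSinkSource s) {a b : Dir}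
           (left : LeftEnd s a) (right : RightEnd s b) where

    lowerPath-coherent : Coherent a (s ∘ low) b
    lowerPath-coherent = steps , proj₁ right
      where
      steps : ∀ i → Compatible (before a (s ∘ low) i) (s (low i))
      steps fzero    = proj₁ left
      steps (fsuc j) = degree-two-compatible nss (incident-inner j) refl refl

    playable-legal : ∀ {i d} → Playable a (s ∘ low) b i d → Legal s (low i) d
    playable-legal {i} {d} (free , l , r) =
      legal nss free (tailSafe i free l) (headSafe (lastOrInject₁ i) free r)
      where
      tailSafe : ∀ i → s (low i) ≡ nothing → Compatible (before a (s ∘ low) i) (just d) →
        TailSafe (play s (low i) d) (low i) d
      tailSafe fzero    free refl = proj₂ left free
      tailSafe (fsuc j) _    l    =
        tailSafe-after (low (inject₁ j)) (inject₁≢suc j ∘ low-injective) refl (compatible-≢ʳ l)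
      headSafe : ∀ {i} → LastOrInject₁ i → s (low i) ≡ nothing → Compatible (just d) (after b (s ∘ low) i) →
        HeadSafe (play s (low i) d) (low i) d
      headSafe last free r with subst (Compatible (just d)) (after-last b (s ∘ low)) r
      ... | refl = proj₂ right free
      headSafe (inject j) _ r =
        headSafe-before (low (fsuc j)) (inject₁≢suc j ∘ sym ∘ low-injective) refl
          (compatible-≢ˡ (subst (Compatible (just d)) (after-inject₁ b (s ∘ low) j) r))

    lowerPath-movable⊎alternating : Movable s ⊎ iterate flip a (countUndirected (s ∘ low)) ≡ b
    lowerPath-movable⊎alternating with playable⊎alternating a (s ∘ low) b lowerPath-coherent
    ... | inj₁ (i , d , playable) = inj₁ (low i , d , playable-legal playable)
    ... | inj₂ alternating        = inj₂ alternating

  module _ {s : State (suc k)} {f : Dir} where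

    leftEnd-blocked : NoSinkSource s → s up ≡ just f → s midL ≡ just f → LeftEnd s (flip f)
    leftEnd-blocked nss su sm =
      ≢-compatibleˡ (start-corner nss su sm) , λ _ → tailSafe-beside up (λ ()) refl (≡just⇒≢flip su)

    rightEnd-blocked : NoSinkSource s → s up ≡ just f → s midR ≡ just f → RightEnd s (flip f)
    rightEnd-blocked nss su sm =
      ≢-compatibleʳ (end-corner nss su sm) , λ _ → headSafe-beside up (λ ()) refl (≡just⇒≢flip su)

    leftEnd-directed : s (low fzero) ≡ just f → LeftEnd s f
    leftEnd-directed sl =
      subst (Compatible (just f)) (sym sl) refl , λ free → ⊥-elim (≡nothing⇒≢just free sl)

    rightEnd-directed : s (low (fromℕ k)) ≡ just f → RightEnd s f
    rightEnd-directed sl =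
      subst (λ x → Compatible x (just f)) (sym sl) refl , λ free → ⊥-elim (≡nothing⇒≢just free sl)

  module _ {s : State (suc k)} (nss : NoSinkSource s) {u : Dir} where

    legal-midL : s midL ≡ nothing → s midR ≢ just (flip u) → s (low fzero) ≢ just u → Legal s midL u
    legal-midL free mr l₀ =
      legal nss free (tailSafe-beside (low fzero) (λ ()) refl l₀) (headSafe-before midR (λ ()) refl mr)

    legal-midR : s midR ≡ nothing → s midL ≢ just (flip u) → s (low (fromℕ k)) ≢ just u → Legal s midR u
    legal-midR free ml lₖ =
      legal nss free (tailSafe-after midL (λ ()) refl ml) (headSafe-beside (low (fromℕ k)) (λ ()) refl lₖ)

  module _ {s : State (suc k)} (nss : NoSinkSource s) {f : Dir} (su : s up ≡ just f) where

    private
      lowCount : ℕ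
      lowCount = countUndirected (s ∘ low)

    movable-midsDirected : s midL ≡ just f → s midR ≡ just f →
      parity (countUndirected (s ∘ low)) ≡ 1ℙ → Movable s
    movable-midsDirected sl sr odd
      with lowerPath-movable⊎alternating nss (leftEnd-blocked nss su sl) (rightEnd-blocked nss su sr)
    ... | inj₁ movable     = movable
    ... | inj₂ alternating =
      ⊥-elim (flip-≢ (flip f) (trans (sym (iterate-flip-odd lowCount (flip f) odd)) alternating))

    movable-midLOpen : s midL ≡ nothing → s midR ≡ just f →
      parity (suc (countUndirected (s ∘ low))) ≡ 1ℙ → Movable s
    movable-midLOpen sl sr odd with ≡-dec _≟D_ (s (low fzero)) (just f)
    ... | no l₀≢f = midL , f , legal-midL nss sl (≡just⇒≢flip sr) l₀≢f
    ... | yes l₀≡f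
      with lowerPath-movable⊎alternating nss (leftEnd-directed l₀≡f) (rightEnd-blocked nss su sr)
    ...   | inj₁ movable     = movable
    ...   | inj₂ alternating =
      ⊥-elim (flip-≢ f (trans (sym alternating) (iterate-flip-even lowCount f (parity-pred lowCount odd))))

    movable-midROpen : s midL ≡ just f → s midR ≡ nothing →
      parity (suc (countUndirected (s ∘ low))) ≡ 1ℙ → Movable s
    movable-midROpen sl sr odd with ≡-dec _≟D_ (s (low (fromℕ k))) (just f)
    ... | no lₖ≢f = midR , f , legal-midR nss sr (≡just⇒≢flip sl) lₖ≢f
    ... | yes lₖ≡f
      with lowerPath-movable⊎alternating nss (leftEnd-blocked nss su sl) (rightEnd-directed lₖ≡f)
    ...   | inj₁ movable     = movable
    ...   | inj₂ alternating =
      ⊥-elim (flip-≢ f (trans (sym (iterate-flip-even lowCount (flip f) (parity-pred lowCount odd)))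
                              alternating))

-- A middle edge directed along up can never lie on a directed triangle.

TriangleBlocked : ∀ {k} → State k → Set
TriangleBlocked s = ∃[ f ] s up ≡ just f × (s midL ≡ just f ⊎ s midR ≡ just f)

triangleBlocked-movable : ∀ {k} {s : State (suc k)} → NoSinkSource s → TriangleBlocked s →
  parity (unplayed s) ≡ 1ℙ → Movable s
triangleBlocked-movable {s = s} nss (f , su , mids) odd
  with s midL in sl | s midR in sr | trans (cong parity (sym (unplayed-upDirected {s = s} su))) odd
... | nothing | nothing | _    = ⊥-elim ([ nothing≢just , nothing≢just ]′ mids)
... | nothing | just y  | odd′ = movable-midLOpen nss su sl ([ (λ ()) , trans sr ]′ mids) odd′
... | just x  | nothing | odd′ = movable-midROpen nss su ([ trans sl , (λ ()) ]′ mids) sr odd′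
... | just x  | just y  | odd′ =
  movable-midsDirected nss su (trans sl (cong just x≡f)) (trans sr (cong just y≡f)) odd′
  where
  x≡y : x ≡ y
  x≡y = mid-agrees nss sl sr
  x≡f : x ≡ f
  x≡f = [ just-injective , trans x≡y ∘ just-injective ]′ mids
  y≡f : y ≡ f
  y≡f = trans (sym x≡y) x≡f

module _ {k : ℕ} {s : State k} where

  triangle-directed : ∀ {u} → s up ≡ just u → s midL ≡ just (flip u) → s midR ≡ just (flip u) →
    CycleDirected s triangle
  triangle-directed {fwd} su sl sr = inj₁ λ where
    up   .fwd refl → su
    midL .bwd refl → sl
    midR .bwd refl → sr
  triangle-directed {bwd} su sl sr = inj₂ λ where
    up   .fwd refl → su
    midL .bwd refl → sl
    midR .bwd refl → sr

  directedTriangle-shape : CycleDirected s triangle →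
    ∃[ u ] s up ≡ just u × s midL ≡ just (flip u) × s midR ≡ just (flip u)
  directedTriangle-shape (inj₁ h) = fwd , h up fwd refl , h midL bwd refl , h midR bwd refl
  directedTriangle-shape (inj₂ h) = bwd , h up fwd refl , h midL bwd refl , h midR bwd refl

  cell-directed : ∀ {c e d} → CycleDirected s c → trav c e ≡ just d → s e ≢ nothing
  cell-directed (inj₁ h) t free = ≡nothing⇒≢just free (h _ _ t)
  cell-directed (inj₂ h) t free = ≡nothing⇒≢just free (h _ _ t)

  midUndirected-noCycle : s midL ≡ nothing ⊎ s midR ≡ nothing → ¬ SomeCycle s
  midUndirected-noCycle undirected (triangle , directed) =
    [ cell-directed directed refl , cell-directed directed refl ]′ undirected
  midUndirected-noCycle undirected (big , directed) =
    [ cell-directed directed refl , cell-directed directed refl ]′ undirected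

  directedBig-complete : s up ≢ nothing → CycleDirected s big → unplayed s ≡ 0
  directedBig-complete upDirected directed = countUndirected-directed {g = s ∘ edgeAt} λ where
    fzero                  → upDirected
    (fsuc fzero)           → cell-directed directed refl
    (fsuc (fsuc fzero))    → cell-directed directed refl
    (fsuc (fsuc (fsuc i))) → cell-directed directed refl

  triangleBlocked-noTriangle : TriangleBlocked s → ¬ CycleDirected s triangle
  triangleBlocked-noTriangle (f , su , mids) directed with directedTriangle-shape directed
  ... | u , su′ , sl , sr with just-injective (trans (sym su) su′)
  ... | refl = [ notAlongUp sl , notAlongUp sr ]′ mids
    where
    notAlongUp : ∀ {x} → x ≡ just (flip f) → x ≢ just f
    notAlongUp x≡flip x≡f = flip-≢ f (just-injective (trans (sym x≡flip) x≡f))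

triangleBlocked-play : ∀ {k} (s : State k) e d → s e ≡ nothing →
  TriangleBlocked s → TriangleBlocked (play s e d)
triangleBlocked-play s e d free (f , su , mids) = f , keep su , Sum.map keep keep mids
  where
  keep : ∀ {f x} → s f ≡ just x → play s e d f ≡ just x
  keep = play-keeps-directed s d free

module _ {k : ℕ} where

  triangleBlocked-win′  : ∀ n {s : State (suc k)} → unplayed s ≡ n → parity n ≡ 1ℙ →
    NoSinkSource s → TriangleBlocked s → Win s
  triangleBlocked-lose′ : ∀ n {s : State (suc k)} → unplayed s ≡ n → parity n ≡ 0ℙ →
    NoSinkSource s → TriangleBlocked s → Lose s

  triangleBlocked-win′ (suc n) {s} count odd nss blocked
    with triangleBlocked-movable nss blocked (subst (λ m → parity m ≡ 1ℙ) (sym count) odd)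
  ... | e , d , lg = move e d lg (inj₂ (triangleBlocked-lose′ n (unplayed-legal lg count) (parity-pred n odd)
                                        (proj₂ lg) (triangleBlocked-play s e d (proj₁ lg) blocked)))

  triangleBlocked-lose′ zero {s} count _ _ _ = allMoves λ e d lg →
    ⊥-elim (ℕₚ.0≢1+n (trans (sym count) (unplayed-play s e d (proj₁ lg))))
  triangleBlocked-lose′ (suc n) {s} count even nss blocked = allMoves response
    where
    response : ∀ e d → Legal s e d → ¬ SomeCycle (play s e d) × Win (play s e d)
    response e d lg = noCycle , triangleBlocked-win′ n count′ odd (proj₂ lg) blocked′
      where
      blocked′ : TriangleBlocked (play s e d)
      blocked′ = triangleBlocked-play s e d (proj₁ lg) blocked
      count′ : unplayed (play s e d) ≡ n
      count′ = unplayed-legal lg count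
      odd : parity n ≡ 1ℙ
      odd = parity-pred n even
      noCycle : ¬ SomeCycle (play s e d)
      noCycle (triangle , directed) = triangleBlocked-noTriangle blocked′ directed
      noCycle (big      , directed) = ℙₚ.p≢p⁻¹ 0ℙ (trans (cong parity (trans (sym complete) count′)) odd)
        where
        complete : unplayed (play s e d) ≡ 0
        complete = directedBig-complete (λ free → ≡nothing⇒≢just free (proj₁ (proj₂ blocked′))) directed

  triangleBlocked-win : ∀ {s : State (suc k)} → NoSinkSource s → TriangleBlocked s →
    parity (unplayed s) ≡ 1ℙ → Win s
  triangleBlocked-win nss blocked odd = triangleBlocked-win′ _ refl odd nss blocked

  triangleBlocked-lose : ∀ {s : State (suc k)} → NoSinkSource s → TriangleBlocked s →
    parity (unplayed s) ≡ 0ℙ → Lose s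
  triangleBlocked-lose nss blocked even = triangleBlocked-lose′ _ refl even nss blocked

module _ {k : ℕ} {t : State (suc k)} (nss : NoSinkSource t) {u : Dir} (tu : t up ≡ just u) where

  completeTriangle-viaMidR : t midL ≡ just (flip u) → t midR ≡ nothing → Win t
  completeTriangle-viaMidR tl tr =
    move midR (flip u) lg (inj₁ (triangle , triangle-directed tu tl (play-≡ t midR (flip u))))
    where
    lg : Legal t midR (flip u)
    lg = legal nss tr (tailSafe-after midL (λ ()) refl (≡just⇒≢flip tl))
                      (headSafe-beside up (λ ()) refl (≡just⇒≢flip tu))

  completeTriangle-viaMidL : t midR ≡ just (flip u) → t midL ≡ nothing → Win t
  completeTriangle-viaMidL tr tl =
    move midL (flip u) lg (inj₁ (triangle , triangle-directed tu (play-≡ t midL (flip u)) tr))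
    where
    lg : Legal t midL (flip u)
    lg = legal nss tl (tailSafe-beside up (λ ()) refl (≡just⇒≢flip tu))
                      (headSafe-before midR (λ ()) refl (≡just⇒≢flip tr))

module _ {k : ℕ} {s : State (suc (suc k))} (nss : NoSinkSource s) {u : Dir}
         (su : s up ≡ just u) (sl : s midL ≡ nothing) (sr : s midR ≡ nothing)
         (lows : ∀ i → s (low i) ≢ just u) (even : parity (unplayed s) ≡ 0ℙ) where

  middleOpen-lose : Lose s
  middleOpen-lose = allMoves response
    where
    block : ∀ {e d} → Legal s e d → ∀ e′ → Legal (play s e d) e′ u →
      TriangleBlocked (play (play s e d) e′ u) → Win (play s e d)
    block lg e′ lg′ blocked =
      move e′ u lg′ (inj₂ (triangleBlocked-lose (proj₂ lg′) blocked (trans (parity-afterTwo lg lg′) even)))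

    oddAfter : ∀ {e d} → Legal s e d → parity (unplayed (play s e d)) ≡ 1ℙ
    oddAfter lg = trans (parity-after lg) (cong _⁻¹ even)

    answerMidL : ∀ d → Legal s midL d → Win (play s midL d)
    answerMidL d lg with d ≟D u
    ... | yes refl = triangleBlocked-win (proj₂ lg) (u , su , inj₁ (play-≡ s midL u)) (oddAfter lg)
    ... | no d≢u with ≢⇒flip (d≢u ∘ sym)
    ...   | refl = completeTriangle-viaMidR (proj₂ lg) su (play-≡ s midL (flip u)) sr

    answerMidR : ∀ d → Legal s midR d → Win (play s midR d)
    answerMidR d lg with d ≟D u
    ... | yes refl = triangleBlocked-win (proj₂ lg) (u , su , inj₂ (play-≡ s midR u)) (oddAfter lg)
    ... | no d≢u with ≢⇒flip (d≢u ∘ sym)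
    ...   | refl = completeTriangle-viaMidL (proj₂ lg) su (play-≡ s midR (flip u)) sl

    answerLow : ∀ i d → Legal s (low i) d → Win (play s (low i) d)
    answerLow i d lg with i Fin.≟ fzero
    ... | yes refl = block lg midR (legal-midR (proj₂ lg) sr (≡nothing⇒≢just sl) lastUnchanged)
                       (u , su , inj₂ (play-≡ (play s (low fzero) d) midR u))
      where
      lastUnchanged : play s (low fzero) d (low (fromℕ (suc k))) ≢ just u
      lastUnchanged =
        subst (_≢ just u) (sym (play-≢ s {low fzero} {low (fromℕ (suc k))} d λ ())) (lows (fromℕ (suc k)))
    ... | no i≢0   = block lg midL (legal-midL (proj₂ lg) sl (≡nothing⇒≢just sr) firstUnchanged)
                       (u , su , inj₁ (play-≡ (play s (low i) d) midL u))
      where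
      firstUnchanged : play s (low i) d (low fzero) ≢ just u
      firstUnchanged =
        subst (_≢ just u) (sym (play-≢ s {low i} {low fzero} d (i≢0 ∘ sym ∘ low-injective))) (lows fzero)

    response : ∀ e d → Legal s e d → ¬ SomeCycle (play s e d) × Win (play s e d)
    response up      d (free , _) = ⊥-elim (≡nothing⇒≢just free su)
    response midL    d lg         = midUndirected-noCycle (inj₂ sr) , answerMidL d lg
    response midR    d lg         = midUndirected-noCycle (inj₁ sl) , answerMidR d lg
    response (low i) d lg         = midUndirected-noCycle (inj₁ sl) , answerLow i d lg

player1-wins : ∀ {k} → Even (2 + k) → Player1Wins (2 + k)
player1-wins {k} even =
  move up fwd lg (inj₂ (middleOpen-lose (proj₂ lg) refl refl refl (λ _ ()) evenAfterUp))
  where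
  lg : Legal (initial (2 + k)) up fwd
  lg = legal-free initial-noSinkSource refl (midL , (λ ()) , inj₁ refl , refl) (midR , (λ ()) , inj₂ refl , refl)
  evenAfterUp : parity (unplayed (play (initial (2 + k)) up fwd)) ≡ 0ℙ
  evenAfterUp = trans (cong parity (countUndirected-nothing (2 + k))) (even-parity even)

player2-wins : ∀ {k} → Odd (2 + k) → Player2Wins (2 + k)
player2-wins {k} odd = allMoves response
  where
  s₀ : State (2 + k)
  s₀ = initial (2 + k)

  evenAfterTwo : ∀ {e d e′ d′} (lg : Legal s₀ e d) → Legal (play s₀ e d) e′ d′ →
    parity (unplayed (play (play s₀ e d) e′ d′)) ≡ 0ℙ
  evenAfterTwo lg lg′ = trans (parity-afterTwo lg lg′)
    (trans (cong parity (unplayed-initial (2 + k))) (trans (parity-suc (2 + k)) (cong _⁻¹ (odd-parity odd))))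

  block : ∀ {e d} → Legal s₀ e d → ∀ e′ d′ (lg′ : Legal (play s₀ e d) e′ d′) →
    TriangleBlocked (play (play s₀ e d) e′ d′) → Win (play s₀ e d)
  block lg e′ d′ lg′ blocked =
    move e′ d′ lg′ (inj₂ (triangleBlocked-lose (proj₂ lg′) blocked (evenAfterTwo lg lg′)))

  response : ∀ e d → Legal s₀ e d → ¬ SomeCycle (play s₀ e d) × Win (play s₀ e d)
  response up d lg = midUndirected-noCycle (inj₁ refl) ,
    block lg midL d (legal-free (proj₂ lg) refl (low fzero , (λ ()) , inj₁ refl , refl)
                                                (midR , (λ ()) , inj₁ refl , refl))
      (d , refl , inj₁ refl)
  response midL d lg = midUndirected-noCycle (inj₂ refl) ,
    block lg up d (legal-free (proj₂ lg) refl (low fzero , (λ ()) , inj₁ refl , refl)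
                                              (midR , (λ ()) , inj₂ refl , refl))
      (d , refl , inj₁ refl)
  response midR d lg = midUndirected-noCycle (inj₁ refl) ,
    block lg up d (legal-free (proj₂ lg) refl (midL , (λ ()) , inj₁ refl , refl)
                                              (low (fromℕ (suc k)) , (λ ()) , inj₂ refl , refl))
      (d , refl , inj₂ refl)
  response (low i) d lg = midUndirected-noCycle (inj₁ refl) ,
    move up (flip d) lg′ (inj₂ (middleOpen-lose (proj₂ lg′) refl refl refl lows (evenAfterTwo lg lg′)))
    where
    lg′ : Legal (play s₀ (low i) d) up (flip d)
    lg′ = legal-free (proj₂ lg) refl (midL , (λ ()) , inj₁ refl , refl) (midR , (λ ()) , inj₂ refl , refl)
    lows : ∀ j → play s₀ (low i) d (low j) ≢ just (flip d)
    lows j = [ ≡just⇒≢flip , ≡nothing⇒≢just ]′ (play-≡⊎≡ s₀ (low i) d (low j))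

-- The hypothesis is used only as k ≥ 2.
theorem4 : (k : ℕ) → 4 ≤ k →
    (Even k → Player1Wins k) × (Odd k → Player2Wins k)
theorem4 zero          ()
theorem4 (suc zero)    (s≤s ())
theorem4 (suc (suc k)) _ = player1-wins , player2-wins
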